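{- Let $e$ and $n$ be positive integers with $e$ odd, and let $w_n(x):=\prod_{i=1}^n\frac{1-x^{e+2i}}{1-x^{2i}}$. Then the rational function $\varphi_n(x)\,w_n(x)$ is a polynomial with integer coefficients, i.e. $\varphi_n(x)w_n(x)\in\mathbb{Z}[x]$.
   Context: For $t\geq1$, $\Phi_t(x):=\prod_{1\le k\le t,\ \gcd(k,t)=1}(x-e^{2ik\pi/t})\in\mathbb{Z}[x]$ is the $t$-th cyclotomic polynomial. Define $\varphi_n(x):=\prod_{k=1}^{n}\Phi_{2k}(x)^{\lfloor n/k\rfloor}=\Phi_2(x)^n\Phi_4(x)^{\lfloor n/2\rfloor}\cdots\Phi_{2n}(x)$. -}

module Defs where

open import Data.Nat as ℕ using (ℕ; zero; suc)
open import Data.Nat.DivMod using (_/_)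
open import Data.Nat.Divisibility using (_∣?_)
open import Data.Integer as ℤ using (ℤ; +_; -_)
open import Data.List using (List; []; _∷_; map; foldr; upTo; filter; replicate; _++_)
open import Relation.Binary.PropositionalEquality using (_≡_)

-- Polynomials in ℤ[x], as coefficient lists (constant term first).
-- Equality is semantic: equality of all coefficients (trailing zeros ignored).
Poly : Set
Poly = List ℤ

coeff : Poly → ℕ → ℤ
coeff []       _       = + 0
coeff (a ∷ p)  zero    = a
coeff (a ∷ p)  (suc k) = coeff p k

infix 4 _≈ₚ_
_≈ₚ_ : Poly → Poly → Set
p ≈ₚ q = ∀ k → coeff p k ≡ coeff q k

infixl 6 _+ₚ_ _-ₚ_
infixl 7 _*ₚ_
infixr 8 _^ₚ_

_+ₚ_ : Poly → Poly → Poly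
[]      +ₚ q       = q
(a ∷ p) +ₚ []      = a ∷ p
(a ∷ p) +ₚ (b ∷ q) = (a ℤ.+ b) ∷ (p +ₚ q)

negₚ : Poly → Poly
negₚ = map -_

_-ₚ_ : Poly → Poly → Poly
p -ₚ q = p +ₚ negₚ q

_*ₚ_ : Poly → Poly → Poly
[]      *ₚ q = []
(a ∷ p) *ₚ q = map (a ℤ.*_) q +ₚ (+ 0 ∷ (p *ₚ q))

oneₚ : Poly
oneₚ = + 1 ∷ []

Xpow : ℕ → Poly
Xpow m = replicate m (+ 0) ++ (+ 1 ∷ [])

_^ₚ_ : Poly → ℕ → Poly
p ^ₚ zero  = oneₚ
p ^ₚ suc m = p *ₚ (p ^ₚ m)

prodₚ : List Poly → Poly
prodₚ = foldr _*ₚ_ oneₚ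

range1 : ℕ → List ℕ
range1 n = map suc (upTo n)

divisors : ℕ → List ℕ
divisors t = filter (λ d → d ∣? t) (range1 t)

-- A family Φ : ℕ → ℤ[x] is the family of cyclotomic polynomials iff
-- for every t ≥ 1,  ∏_{d ∣ t} Φ_d(x) = x^t − 1.
-- (This determines Φ_t uniquely for all t ≥ 1, by strong induction,
--  since ℤ[x] is an integral domain.)
IsCyclotomic : (ℕ → Poly) → Set
IsCyclotomic Φ = ∀ t → 1 ℕ.≤ t → prodₚ (map Φ (divisors t)) ≈ₚ (Xpow t -ₚ oneₚ)

-- φ_n(x) = ∏_{k=1}^n Φ_{2k}(x)^{⌊n/k⌋}
varphi : (ℕ → Poly) → ℕ → Poly
-- (index j ∈ {0..n-1} stands for k = j+1)
varphi Φ n = prodₚ (map (λ j → Φ (2 ℕ.* suc j) ^ₚ (n / suc j)) (upTo n))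

wNum : ℕ → ℕ → Poly
wNum e n = prodₚ (map (λ i → oneₚ -ₚ Xpow (e ℕ.+ 2 ℕ.* i)) (range1 n))

wDen : ℕ → Poly
wDen n = prodₚ (map (λ i → oneₚ -ₚ Xpow (2 ℕ.* i)) (range1 n))

{-# OPTIONS --safe #-}
-- Since 1 − x^t = −∏_{d ∣ t} Φ_d, the numerator and the denominator of w_n are, up to the
-- same sign (−1)^n, products of cyclotomic polynomials, Φ_d occurring #{i ≤ n : d ∣ e + 2i}
-- times upstairs and #{i ≤ n : d ∣ 2i} times downstairs. So it suffices that every Φ_d
-- occurs in the denominator at most as often as in φ_n times the numerator. For d = 2k the
-- denominator count is #{i ≤ n : k ∣ i} = ⌊n/k⌋, the exponent of Φ_{2k} in φ_n. For odd d it
-- is ⌊n/d⌋, and since 2 is invertible modulo d, among any d consecutive i there is one with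
-- d ∣ e + 2i, so the numerator contains Φ_d at least ⌊n/d⌋ times.
module Submission where

open import Defs
open import Algebra.Bundles using (CommutativeMonoid)
open import Algebra.Structures using (IsCommutativeMonoid)
open import Data.Integer as ℤ using (ℤ; +_; -_)
import Data.Integer.Properties as ℤ
open import Data.Integer.Tactic.RingSolver using (solve-∀)
open import Data.List using (List; []; _∷_; _++_; [_]; map; length; filter; concat; concatMap; replicate; upTo; applyUpTo)
open import Data.List.Properties
  using (map-∘; map-cong; map-id; map-++; map-upTo; upTo-∷ʳ; length-++; length-replicate;
         filter-++; filter-none; filter-all; filter-accept; filter-reject; filter-some)
open import Data.List.Membership.Propositional using (_∈_; _∉_)
open import Data.List.Membership.Propositional.Properties
  using (∈-∃++; ∈-filter⁺; ∈-filter⁻; ∈-map⁺; ∈-upTo⁺; ∈-applyUpTo⁺)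
open import Data.List.Relation.Unary.All as All using (All; []; _∷_)
import Data.List.Relation.Unary.All.Properties as All
import Data.List.Relation.Unary.Any as Any
open import Data.List.Relation.Unary.Any using (here; there)
open import Data.List.Relation.Unary.AllPairs using ([]; _∷_)
open import Data.List.Relation.Unary.Unique.Propositional using (Unique)
import Data.List.Relation.Unary.Unique.Propositional.Properties as Unique
open import Data.List.Relation.Binary.Permutation.Propositional using (_↭_; ↭-refl; ↭-trans; ↭-prep; ↭⇒↭ₛ′)
import Data.List.Relation.Binary.Permutation.Propositional.Properties as ↭
open import Data.List.Relation.Binary.Permutation.Propositional.Properties using (↭-length; filter-↭) renaming (shift to ↭-shift)
import Data.List.Relation.Binary.Permutation.Setoid.Properties as ↭ₛ
open import Data.Nat using (ℕ; zero; suc; _+_; _*_; _≤_; _<_; _≟_; _/_; _%_; z≤n; s≤s; _<?_; NonZero; >-nonZero⁻¹)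
open import Data.Nat.DivMod using (m≡m%n+[m/n]*n; /-monoˡ-≤; m<n*o⇒m/o<n; m*n/n≡m; m<n⇒m/n≡0)
open import Data.Nat.Divisibility
  using (_∣_; _∣?_; divides; ∣-trans; ∣⇒≤; 0∣⇒≡0; n∣m*n; ∣m+n∣m⇒∣n; ∣m∣n⇒∣m+n; *-cancelˡ-∣)
open import Data.Nat.Properties
  using (suc-injective; ≤-trans; ≤-reflexive; +-comm; +-assoc; +-identityʳ; +-suc; m≤m+n; m≤n+m; n≤1+n;
         +-cancelˡ-≡; +-cancelˡ-≤; +-mono-≤; ≮⇒≥; module ≤-Reasoning)
import Data.Nat.Tactic.RingSolver as ℕ
open import Data.Product using (Σ; ∃; _,_; proj₂)
open import Data.Sum using (_⊎_; inj₁; inj₂)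
open import Function using (_∘_; _⇔_; mk⇔; Equivalence)
open import Level using (Level; 0ℓ)
open import Relation.Binary.Bundles using (Setoid)
import Relation.Binary.Reasoning.Setoid as SetoidReasoning
open import Relation.Binary.Definitions using (DecidableEquality)
open import Relation.Binary.Structures using (IsEquivalence)
open import Relation.Binary.PropositionalEquality
  using (_≡_; _≗_; refl; sym; trans; cong; cong₂; subst; subst₂; module ≡-Reasoning)
open import Relation.Nullary using (yes; no; ¬_; contradiction)
open import Relation.Unary using (Pred; Decidable; ∁)

private variable
  a p q : Level
  A : Set a

-- Polynomial arithmetic up to coefficientwise equality

-- A record rather than ≈ₚ itself, so that both polynomials can be inferred from a proof.
infix 4 _≋_
record _≋_ (p q : Poly) : Set where
  constructor coeffwise
  field coeff-≡ : p ≈ₚ q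
open _≋_

≋-isEquivalence : IsEquivalence _≋_
≋-isEquivalence = record
  { refl  = coeffwise λ _ → refl
  ; sym   = λ (coeffwise e) → coeffwise λ k → sym (e k)
  ; trans = λ (coeffwise e) (coeffwise f) → coeffwise λ k → trans (e k) (f k)
  }

≋-setoid : Setoid 0ℓ 0ℓ
≋-setoid = record { isEquivalence = ≋-isEquivalence }

open Setoid ≋-setoid using () renaming (refl to ≋-refl; sym to ≋-sym; trans to ≋-trans; reflexive to ≋-reflexive)
module ≋-Reasoning = SetoidReasoning ≋-setoid

infixr 7 _·ₚ_
_·ₚ_ : ℤ → Poly → Poly
a ·ₚ p = map (a ℤ.*_) p

shiftₚ : Poly → Poly
shiftₚ p = + 0 ∷ p

coeff-+ₚ : ∀ p q k → coeff (p +ₚ q) k ≡ coeff p k ℤ.+ coeff q k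
coeff-+ₚ []      q       k       = sym (ℤ.+-identityˡ _)
coeff-+ₚ (a ∷ p) []      k       = sym (ℤ.+-identityʳ _)
coeff-+ₚ (a ∷ p) (b ∷ q) zero    = refl
coeff-+ₚ (a ∷ p) (b ∷ q) (suc k) = coeff-+ₚ p q k

coeff-·ₚ : ∀ a p k → coeff (a ·ₚ p) k ≡ a ℤ.* coeff p k
coeff-·ₚ a []      k       = sym (ℤ.*-zeroʳ a)
coeff-·ₚ a (b ∷ p) zero    = refl
coeff-·ₚ a (b ∷ p) (suc k) = coeff-·ₚ a p k

coeff-negₚ : ∀ p k → coeff (negₚ p) k ≡ - coeff p k
coeff-negₚ []      k       = refl
coeff-negₚ (a ∷ p) zero    = refl
coeff-negₚ (a ∷ p) (suc k) = coeff-negₚ p k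

∷-cong : ∀ {a b p q} → a ≡ b → p ≋ q → a ∷ p ≋ b ∷ q
∷-cong a≡b (coeffwise e) = coeffwise λ { zero → a≡b ; (suc k) → e k }

shiftₚ-[] : shiftₚ [] ≋ []
shiftₚ-[] = coeffwise λ { zero → refl ; (suc k) → refl }

+ₚ-cong : ∀ {p p′ q q′} → p ≋ p′ → q ≋ q′ → p +ₚ q ≋ p′ +ₚ q′
+ₚ-cong {p} {p′} {q} {q′} (coeffwise e) (coeffwise f) = coeffwise λ k → begin
  coeff (p +ₚ q) k            ≡⟨ coeff-+ₚ p q k ⟩
  coeff p k ℤ.+ coeff q k     ≡⟨ cong₂ ℤ._+_ (e k) (f k) ⟩
  coeff p′ k ℤ.+ coeff q′ k   ≡⟨ coeff-+ₚ p′ q′ k ⟨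
  coeff (p′ +ₚ q′) k          ∎
  where open ≡-Reasoning

+ₚ-identityʳ : ∀ p → p +ₚ [] ≡ p
+ₚ-identityʳ []      = refl
+ₚ-identityʳ (a ∷ p) = refl

+ₚ-assoc : ∀ p q r → (p +ₚ q) +ₚ r ≡ p +ₚ (q +ₚ r)
+ₚ-assoc []      q       r       = refl
+ₚ-assoc (a ∷ p) []      r       = refl
+ₚ-assoc (a ∷ p) (b ∷ q) []      = refl
+ₚ-assoc (a ∷ p) (b ∷ q) (c ∷ r) = cong₂ _∷_ (ℤ.+-assoc a b c) (+ₚ-assoc p q r)

+ₚ-comm : ∀ p q → p +ₚ q ≡ q +ₚ p
+ₚ-comm []      q       = sym (+ₚ-identityʳ q)
+ₚ-comm (a ∷ p) []      = refl
+ₚ-comm (a ∷ p) (b ∷ q) = cong₂ _∷_ (ℤ.+-comm a b) (+ₚ-comm p q)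

+ₚ-isCommutativeMonoid : IsCommutativeMonoid _≋_ _+ₚ_ []
+ₚ-isCommutativeMonoid = record
  { isMonoid = record
    { isSemigroup = record
      { isMagma = record { isEquivalence = ≋-isEquivalence ; ∙-cong = +ₚ-cong }
      ; assoc   = λ p q r → ≋-reflexive (+ₚ-assoc p q r)
      }
    ; identity = (λ _ → ≋-refl) , ≋-reflexive ∘ +ₚ-identityʳ
    }
  ; comm = λ p q → ≋-reflexive (+ₚ-comm p q)
  }

+ₚ-commutativeMonoid : CommutativeMonoid 0ℓ 0ℓ
+ₚ-commutativeMonoid = record { isCommutativeMonoid = +ₚ-isCommutativeMonoid }

open import Algebra.Properties.CommutativeSemigroup
  (CommutativeMonoid.commutativeSemigroup +ₚ-commutativeMonoid)
  using () renaming (interchange to +ₚ-interchange; x∙yz≈y∙xz to +ₚ-swapˡ)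

·ₚ-cong : ∀ a {p q} → p ≋ q → a ·ₚ p ≋ a ·ₚ q
·ₚ-cong a {p} {q} (coeffwise e) = coeffwise λ k → begin
  coeff (a ·ₚ p) k     ≡⟨ coeff-·ₚ a p k ⟩
  a ℤ.* coeff p k      ≡⟨ cong (a ℤ.*_) (e k) ⟩
  a ℤ.* coeff q k      ≡⟨ coeff-·ₚ a q k ⟨
  coeff (a ·ₚ q) k     ∎
  where open ≡-Reasoning

·ₚ-distribˡ : ∀ a p q → a ·ₚ (p +ₚ q) ≡ a ·ₚ p +ₚ a ·ₚ q
·ₚ-distribˡ a []      q       = refl
·ₚ-distribˡ a (x ∷ p) []      = refl
·ₚ-distribˡ a (x ∷ p) (y ∷ q) = cong₂ _∷_ (ℤ.*-distribˡ-+ a x y) (·ₚ-distribˡ a p q)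

·ₚ-distribʳ : ∀ a b p → (a ℤ.+ b) ·ₚ p ≡ a ·ₚ p +ₚ b ·ₚ p
·ₚ-distribʳ a b []      = refl
·ₚ-distribʳ a b (x ∷ p) = cong₂ _∷_ (ℤ.*-distribʳ-+ x a b) (·ₚ-distribʳ a b p)

·ₚ-assoc : ∀ a b p → a ·ₚ b ·ₚ p ≡ (a ℤ.* b) ·ₚ p
·ₚ-assoc a b p = trans (sym (map-∘ p)) (map-cong (λ x → sym (ℤ.*-assoc a b x)) p)

·ₚ-identityˡ : ∀ p → + 1 ·ₚ p ≡ p
·ₚ-identityˡ p = trans (map-cong ℤ.*-identityˡ p) (map-id p)

·ₚ-zeroˡ : ∀ p → + 0 ·ₚ p ≋ []
·ₚ-zeroˡ []      = ≋-refl
·ₚ-zeroˡ (x ∷ p) = ≋-trans (∷-cong (ℤ.*-zeroˡ x) (·ₚ-zeroˡ p)) shiftₚ-[]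

·ₚ-shiftₚ : ∀ a p → a ·ₚ shiftₚ p ≋ shiftₚ (a ·ₚ p)
·ₚ-shiftₚ a p = ∷-cong (ℤ.*-zeroʳ a) ≋-refl

*ₚ-congˡ : ∀ p {q q′} → q ≋ q′ → p *ₚ q ≋ p *ₚ q′
*ₚ-congˡ []      q≋q′ = ≋-refl
*ₚ-congˡ (a ∷ p) q≋q′ = +ₚ-cong (·ₚ-cong a q≋q′) (∷-cong refl (*ₚ-congˡ p q≋q′))

*ₚ-zeroʳ : ∀ p → p *ₚ [] ≋ []
*ₚ-zeroʳ []      = ≋-refl
*ₚ-zeroʳ (a ∷ p) = ≋-trans (∷-cong refl (*ₚ-zeroʳ p)) shiftₚ-[]

*ₚ-constantˡ : ∀ c q → (c ∷ []) *ₚ q ≋ c ·ₚ q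
*ₚ-constantˡ c q = ≋-trans (+ₚ-cong ≋-refl shiftₚ-[]) (≋-reflexive (+ₚ-identityʳ (c ·ₚ q)))

*ₚ-∷ʳ : ∀ q a p → q *ₚ (a ∷ p) ≋ a ·ₚ q +ₚ shiftₚ (q *ₚ p)
*ₚ-∷ʳ []      a p = ≋-sym shiftₚ-[]
*ₚ-∷ʳ (b ∷ q) a p = ∷-cong (cong (ℤ._+ + 0) (ℤ.*-comm b a))
  (≋-trans (+ₚ-cong ≋-refl (*ₚ-∷ʳ q a p)) (+ₚ-swapˡ (b ·ₚ p) (a ·ₚ q) _))

*ₚ-comm : ∀ p q → p *ₚ q ≋ q *ₚ p
*ₚ-comm []      q = ≋-sym (*ₚ-zeroʳ q)
*ₚ-comm (a ∷ p) q = ≋-trans (+ₚ-cong ≋-refl (∷-cong refl (*ₚ-comm p q))) (≋-sym (*ₚ-∷ʳ q a p))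

*ₚ-congʳ : ∀ {p p′} q → p ≋ p′ → p *ₚ q ≋ p′ *ₚ q
*ₚ-congʳ {p} {p′} q p≋p′ = ≋-trans (*ₚ-comm p q) (≋-trans (*ₚ-congˡ q p≋p′) (*ₚ-comm q p′))

*ₚ-distribʳ : ∀ p p′ r → (p +ₚ p′) *ₚ r ≋ p *ₚ r +ₚ p′ *ₚ r
*ₚ-distribʳ []      p′       r = ≋-refl
*ₚ-distribʳ (a ∷ p) []       r = ≋-reflexive (sym (+ₚ-identityʳ _))
*ₚ-distribʳ (a ∷ p) (b ∷ p′) r = ≋-trans
  (+ₚ-cong (≋-reflexive (·ₚ-distribʳ a b r)) (∷-cong refl (*ₚ-distribʳ p p′ r)))
  (+ₚ-interchange (a ·ₚ r) (b ·ₚ r) (shiftₚ (p *ₚ r)) (shiftₚ (p′ *ₚ r)))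

*ₚ-·ₚˡ : ∀ a q r → (a ·ₚ q) *ₚ r ≋ a ·ₚ (q *ₚ r)
*ₚ-·ₚˡ a []      r = ≋-refl
*ₚ-·ₚˡ a (b ∷ q) r = begin
  (a ℤ.* b) ·ₚ r +ₚ shiftₚ ((a ·ₚ q) *ₚ r)   ≈⟨ +ₚ-cong (≋-reflexive (sym (·ₚ-assoc a b r))) (∷-cong refl (*ₚ-·ₚˡ a q r)) ⟩
  a ·ₚ b ·ₚ r +ₚ shiftₚ (a ·ₚ (q *ₚ r))       ≈⟨ +ₚ-cong ≋-refl (·ₚ-shiftₚ a (q *ₚ r)) ⟨
  a ·ₚ b ·ₚ r +ₚ a ·ₚ shiftₚ (q *ₚ r)         ≡⟨ ·ₚ-distribˡ a (b ·ₚ r) (shiftₚ (q *ₚ r)) ⟨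
  a ·ₚ (b ·ₚ r +ₚ shiftₚ (q *ₚ r))            ∎
  where open ≋-Reasoning

*ₚ-shiftˡ : ∀ p r → shiftₚ p *ₚ r ≋ shiftₚ (p *ₚ r)
*ₚ-shiftˡ p r = +ₚ-cong (·ₚ-zeroˡ r) ≋-refl

*ₚ-assoc : ∀ p q r → (p *ₚ q) *ₚ r ≋ p *ₚ (q *ₚ r)
*ₚ-assoc []      q r = ≋-refl
*ₚ-assoc (a ∷ p) q r = begin
  (a ·ₚ q +ₚ shiftₚ (p *ₚ q)) *ₚ r        ≈⟨ *ₚ-distribʳ (a ·ₚ q) (shiftₚ (p *ₚ q)) r ⟩
  (a ·ₚ q) *ₚ r +ₚ shiftₚ (p *ₚ q) *ₚ r   ≈⟨ +ₚ-cong (*ₚ-·ₚˡ a q r) (*ₚ-shiftˡ (p *ₚ q) r) ⟩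
  a ·ₚ (q *ₚ r) +ₚ shiftₚ ((p *ₚ q) *ₚ r) ≈⟨ +ₚ-cong ≋-refl (∷-cong refl (*ₚ-assoc p q r)) ⟩
  a ·ₚ (q *ₚ r) +ₚ shiftₚ (p *ₚ (q *ₚ r)) ∎
  where open ≋-Reasoning

*ₚ-identityˡ : ∀ p → oneₚ *ₚ p ≋ p
*ₚ-identityˡ p = ≋-trans (*ₚ-constantˡ (+ 1) p) (≋-reflexive (·ₚ-identityˡ p))

*ₚ-isCommutativeMonoid : IsCommutativeMonoid _≋_ _*ₚ_ oneₚ
*ₚ-isCommutativeMonoid = record
  { isMonoid = record
    { isSemigroup = record
      { isMagma = record
        { isEquivalence = ≋-isEquivalence
        ; ∙-cong = λ {p} {p′} {q} {q′} p≋p′ q≋q′ → ≋-trans (*ₚ-congʳ q p≋p′) (*ₚ-congˡ p′ q≋q′)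
        }
      ; assoc   = *ₚ-assoc
      }
    ; identity = *ₚ-identityˡ , λ p → ≋-trans (*ₚ-comm p oneₚ) (*ₚ-identityˡ p)
    }
  ; comm = *ₚ-comm
  }

*ₚ-commutativeMonoid : CommutativeMonoid 0ℓ 0ℓ
*ₚ-commutativeMonoid = record { isCommutativeMonoid = *ₚ-isCommutativeMonoid }

open CommutativeMonoid *ₚ-commutativeMonoid using () renaming (∙-cong to *ₚ-cong)
open import Algebra.Properties.CommutativeSemigroup
  (CommutativeMonoid.commutativeSemigroup *ₚ-commutativeMonoid)
  using () renaming (x∙yz≈y∙xz to *ₚ-swapˡ; interchange to *ₚ-interchange)

prodₚ-++ : ∀ ps qs → prodₚ (ps ++ qs) ≋ prodₚ ps *ₚ prodₚ qs
prodₚ-++ []       qs = ≋-sym (*ₚ-identityˡ (prodₚ qs))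
prodₚ-++ (p ∷ ps) qs = ≋-trans (*ₚ-congˡ p (prodₚ-++ ps qs)) (≋-sym (*ₚ-assoc p (prodₚ ps) (prodₚ qs)))

prodₚ-↭ : ∀ {ps qs} → ps ↭ qs → prodₚ ps ≋ prodₚ qs
prodₚ-↭ ps↭qs = ↭ₛ.foldr-commMonoid ≋-setoid *ₚ-isCommutativeMonoid (↭⇒↭ₛ′ ≋-isEquivalence ps↭qs)

1-p≋-1*[p-1] : ∀ p → oneₚ -ₚ p ≋ negₚ oneₚ *ₚ (p -ₚ oneₚ)
1-p≋-1*[p-1] p = ≋-sym (≋-trans (*ₚ-constantˡ (- + 1) (p -ₚ oneₚ)) (coeffwise λ k → begin
  coeff (- + 1 ·ₚ (p -ₚ oneₚ)) k                       ≡⟨ coeff-·ₚ (- + 1) (p -ₚ oneₚ) k ⟩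
  - + 1 ℤ.* coeff (p -ₚ oneₚ) k                         ≡⟨ cong (- + 1 ℤ.*_) (coeff-+ₚ p (negₚ oneₚ) k) ⟩
  - + 1 ℤ.* (coeff p k ℤ.+ coeff (negₚ oneₚ) k)         ≡⟨ cong (λ z → - + 1 ℤ.* (coeff p k ℤ.+ z)) (coeff-negₚ oneₚ k) ⟩
  - + 1 ℤ.* (coeff p k ℤ.+ - coeff oneₚ k)              ≡⟨ negate (coeff p k) (coeff oneₚ k) ⟩
  coeff oneₚ k ℤ.+ - coeff p k                          ≡⟨ cong (λ z → coeff oneₚ k ℤ.+ z) (coeff-negₚ p k) ⟨
  coeff oneₚ k ℤ.+ coeff (negₚ p) k                     ≡⟨ coeff-+ₚ oneₚ (negₚ p) k ⟨
  coeff (oneₚ -ₚ p) k                                   ∎))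
  where
  open ≡-Reasoning
  negate : ∀ x y → - + 1 ℤ.* (x ℤ.+ - y) ≡ y ℤ.+ - x
  negate = solve-∀

-- Multiplicities in lists

count : {P : Pred A p} → Decidable P → List A → ℕ
count P? xs = length (filter P? xs)

module _ {P : Pred A p} (P? : Decidable P) where

  count-++ : ∀ xs ys → count P? (xs ++ ys) ≡ count P? xs + count P? ys
  count-++ xs ys = trans (cong length (filter-++ P? xs ys)) (length-++ (filter P? xs))

  count-↭ : ∀ {xs ys} → xs ↭ ys → count P? xs ≡ count P? ys
  count-↭ xs↭ys = ↭-length (filter-↭ P? xs↭ys)

  count-none : ∀ {xs} → All (∁ P) xs → count P? xs ≡ 0
  count-none ¬Ps = cong length (filter-none P? ¬Ps)

  count-all : ∀ {xs} → All P xs → count P? xs ≡ length xs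
  count-all Ps = cong length (filter-all P? Ps)

  count-∈-concat : ∀ {xs xss} → xs ∈ xss → count P? xs ≤ count P? (concat xss)
  count-∈-concat {xs} {.xs ∷ xss} (here refl) = ≤-trans (m≤m+n _ _) (≤-reflexive (sym (count-++ xs (concat xss))))
  count-∈-concat {xs} {ys ∷ xss}  (there xs∈xss) =
    ≤-trans (≤-trans (count-∈-concat xs∈xss) (m≤n+m _ _)) (≤-reflexive (sym (count-++ ys (concat xss))))

  count-[]-⇔ : ∀ {x y} → P x ⇔ P y → count P? [ x ] ≡ count P? [ y ]
  count-[]-⇔ {x} {y} Px⇔Py with P? x | P? y
  ... | yes _  | yes _  = refl
  ... | yes Px | no ¬Py = contradiction (Equivalence.to Px⇔Py Px) ¬Py
  ... | no ¬Px | yes Py = contradiction (Equivalence.from Px⇔Py Py) ¬Px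
  ... | no _   | no _   = refl

  count-mono : ∀ {Q : Pred A q} (Q? : Decidable Q) → (∀ {x} → P x → Q x) → ∀ xs → count P? xs ≤ count Q? xs
  count-mono Q? P⇒Q []       = z≤n
  count-mono Q? P⇒Q (x ∷ xs) with P? x | Q? x
  ... | yes _  | yes _  = s≤s (count-mono Q? P⇒Q xs)
  ... | yes Px | no ¬Qx = contradiction (P⇒Q Px) ¬Qx
  ... | no _   | yes _  = ≤-trans (count-mono Q? P⇒Q xs) (m≤n+m _ 1)
  ... | no _   | no _   = count-mono Q? P⇒Q xs

module _ (_≟_ : DecidableEquality A) where

  multiplicity : A → List A → ℕ
  multiplicity x = count (x ≟_)

  multiplicity-replicate : ∀ m x → multiplicity x (replicate m x) ≡ m
  multiplicity-replicate m x = trans (count-all (x ≟_) (All.replicate⁺ m refl)) (length-replicate m)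

  multiplicity-∉ : ∀ {x ys} → x ∉ ys → multiplicity x ys ≡ 0
  multiplicity-∉ {x} {ys} x∉ys = count-none (x ≟_) (All.¬Any⇒All¬ ys x∉ys)

  multiplicity-unique : ∀ {x ys} → Unique ys → x ∈ ys → multiplicity x ys ≡ 1
  multiplicity-unique {x} (y∉ys ∷ _) (here refl) =
    trans (cong length (filter-accept (x ≟_) refl)) (cong suc (count-none (x ≟_) y∉ys))
  multiplicity-unique {x} (y∉ys ∷ ys-unique) (there x∈ys) =
    trans (cong length (filter-reject (x ≟_) (λ { refl → All.lookup y∉ys x∈ys refl })))
          (multiplicity-unique ys-unique x∈ys)

  multiplicity-pos⇒∈ : ∀ {x} ys → 0 < multiplicity x ys → x ∈ ys
  multiplicity-pos⇒∈ {x} (y ∷ ys) pos with x ≟ y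
  ... | yes refl = here refl
  ... | no _     = there (multiplicity-pos⇒∈ ys pos)

  multiplicity-self : ∀ x xs → 0 < multiplicity x (x ∷ xs)
  multiplicity-self x xs = filter-some (x ≟_) (here refl)

  multiplicity-∷ : ∀ x y ys → multiplicity x (y ∷ ys) ≡ multiplicity x [ y ] + multiplicity x ys
  multiplicity-∷ x y ys = count-++ (x ≟_) [ y ] ys

  multiplicities-≤-cancel : ∀ x xs ys₁ ys₂ →
    (∀ z → multiplicity z (x ∷ xs) ≤ multiplicity z (ys₁ ++ [ x ] ++ ys₂)) →
    ∀ z → multiplicity z xs ≤ multiplicity z (ys₁ ++ ys₂)
  multiplicities-≤-cancel x xs ys₁ ys₂ ≤ys z = +-cancelˡ-≤ (multiplicity z [ x ]) _ _ (begin
    multiplicity z [ x ] + multiplicity z xs             ≡⟨ multiplicity-∷ z x xs ⟨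
    multiplicity z (x ∷ xs)                              ≤⟨ ≤ys z ⟩
    multiplicity z (ys₁ ++ [ x ] ++ ys₂)                 ≡⟨ count-↭ (z ≟_) (↭-shift x ys₁ ys₂) ⟩
    multiplicity z (x ∷ ys₁ ++ ys₂)                      ≡⟨ multiplicity-∷ z x (ys₁ ++ ys₂) ⟩
    multiplicity z [ x ] + multiplicity z (ys₁ ++ ys₂)   ∎)
    where open ≤-Reasoning

  multiplicities-≤⇒↭-++ : ∀ xs ys → (∀ z → multiplicity z xs ≤ multiplicity z ys) → ∃ λ zs → ys ↭ xs ++ zs
  multiplicities-≤⇒↭-++ []       ys _ = ys , ↭-refl
  multiplicities-≤⇒↭-++ (x ∷ xs) ys ≤ys
    with ys₁ , ys₂ , refl ← ∈-∃++ (multiplicity-pos⇒∈ ys (≤-trans (multiplicity-self x xs) (≤ys x)))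
    with zs , ↭xs++zs ← multiplicities-≤⇒↭-++ xs (ys₁ ++ ys₂) (multiplicities-≤-cancel x xs ys₁ ys₂ ≤ys)
    = zs , ↭-trans (↭-shift x ys₁ ys₂) (↭-prep x ↭xs++zs)

-- Counting divisibility conditions over 1 … n

range1-suc : ∀ n → range1 (suc n) ≡ range1 n ++ [ suc n ]
range1-suc n = trans (cong (map suc) (sym (upTo-∷ʳ n))) (map-++ suc (upTo n) [ n ])

range1-all : ∀ {P : Pred ℕ p} → (∀ i → P (suc i)) → ∀ n → All P (range1 n)
range1-all P-suc n = All.map⁺ (All.universal P-suc (upTo n))

divisors-unique : ∀ t → Unique (divisors t)
divisors-unique t = Unique.filter⁺ (_∣? t) (Unique.map⁺ suc-injective (Unique.upTo⁺ t))

∈-divisors : ∀ {d t} → 1 ≤ t → d ∣ t → d ∈ divisors t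
∈-divisors {zero}  {suc t} _ d∣t with () ← 0∣⇒≡0 d∣t
∈-divisors {suc d} {suc t} _ d∣t = ∈-filter⁺ (_∣? suc t) (∈-map⁺ suc (∈-upTo⁺ (∣⇒≤ d∣t))) d∣t

∉-divisors : ∀ {d t} → ¬ d ∣ t → d ∉ divisors t
∉-divisors {t = t} ¬d∣t d∈ = ¬d∣t (proj₂ (∈-filter⁻ (_∣? t) {xs = range1 t} d∈))

multiplicity-concatMap-divisors : ∀ d (f : ℕ → ℕ) {xs} → All (λ i → 1 ≤ f i) xs →
  multiplicity _≟_ d (concatMap (divisors ∘ f) xs) ≡ count (λ i → d ∣? f i) xs
multiplicity-concatMap-divisors d f []                        = refl
multiplicity-concatMap-divisors d f {x ∷ xs} (1≤fx ∷ 1≤f[xs])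
  rewrite count-++ (d ≟_) (divisors (f x)) (concatMap (divisors ∘ f) xs) with d ∣? f x
... | yes d∣fx = cong₂ _+_ (multiplicity-unique _≟_ (divisors-unique (f x)) (∈-divisors 1≤fx d∣fx))
                           (multiplicity-concatMap-divisors d f 1≤f[xs])
... | no ¬d∣fx = cong₂ _+_ (multiplicity-∉ _≟_ (∉-divisors ¬d∣fx)) (multiplicity-concatMap-divisors d f 1≤f[xs])

count-multiples-≤ : ∀ k .{{_ : NonZero k}} n → count (k ∣?_) (range1 n) ≤ n / k
count-multiples-≤ k zero    = z≤n
count-multiples-≤ k (suc n) = begin
  count (k ∣?_) (range1 (suc n))                         ≡⟨ cong (count (k ∣?_)) (range1-suc n) ⟩
  count (k ∣?_) (range1 n ++ [ suc n ])                  ≡⟨ count-++ (k ∣?_) (range1 n) [ suc n ] ⟩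
  count (k ∣?_) (range1 n) + count (k ∣?_) [ suc n ]     ≤⟨ last-step ⟩
  suc n / k                                              ∎
  where
  open ≤-Reasoning
  last-step : count (k ∣?_) (range1 n) + count (k ∣?_) [ suc n ] ≤ suc n / k
  last-step with k ∣? suc n
  ... | yes (divides q 1+n≡q*k) = begin
    count (k ∣?_) (range1 n) + 1   ≡⟨ +-comm _ 1 ⟩
    suc (count (k ∣?_) (range1 n)) ≤⟨ s≤s (count-multiples-≤ k n) ⟩
    suc (n / k)                    ≤⟨ m<n*o⇒m/o<n (≤-reflexive 1+n≡q*k) ⟩
    q                              ≡⟨ m*n/n≡m q k ⟨
    q * k / k                      ≡⟨ cong (_/ k) 1+n≡q*k ⟨
    suc n / k                      ∎
  ... | no _ = begin
    count (k ∣?_) (range1 n) + 0   ≡⟨ +-identityʳ _ ⟩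
    count (k ∣?_) (range1 n)       ≤⟨ count-multiples-≤ k n ⟩
    n / k                          ≤⟨ /-monoˡ-≤ k (n≤1+n n) ⟩
    suc n / k                      ∎

interval : ℕ → ℕ → List ℕ
interval a n = applyUpTo (_+_ a) n

applyUpTo-+ : ∀ (f : ℕ → A) m n → applyUpTo f (m + n) ≡ applyUpTo f m ++ applyUpTo (f ∘ (_+_ m)) n
applyUpTo-+ f zero    n = refl
applyUpTo-+ f (suc m) n = cong (f 0 ∷_) (applyUpTo-+ (f ∘ suc) m n)

applyUpTo-cong : ∀ {f g : ℕ → A} → f ≗ g → ∀ n → applyUpTo f n ≡ applyUpTo g n
applyUpTo-cong {f = f} {g} f≗g n = trans (sym (map-upTo f n)) (trans (map-cong f≗g (upTo n)) (map-upTo g n))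

interval-+ : ∀ a m n → interval a (m + n) ≡ interval a m ++ interval (a + m) n
interval-+ a m n = trans (applyUpTo-+ (_+_ a) m n) (cong (interval a m ++_) (applyUpTo-cong (λ i → sym (+-assoc a m i)) n))

module _ {P : Pred ℕ p} (P? : Decidable P) (d : ℕ) .{{_ : NonZero d}}
         (periodic : ∀ i → P (i + d) ⇔ P i) {i₀} (P[i₀] : P i₀) where

  private
    window : ℕ → ℕ
    window a = count P? (interval a d)

    window-step : ∀ a → window (a + 1) ≡ window a
    window-step a = +-cancelˡ-≡ (count P? [ a + 0 ]) _ _ (begin
      count P? [ a + 0 ] + window (a + 1)        ≡⟨ count-++ P? [ a + 0 ] (interval (a + 1) d) ⟨
      count P? ([ a + 0 ] ++ interval (a + 1) d) ≡⟨ cong (count P?) (interval-+ a 1 d) ⟨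
      count P? (interval a (1 + d))              ≡⟨ cong (count P? ∘ interval a) (+-comm 1 d) ⟩
      count P? (interval a (d + 1))              ≡⟨ cong (count P?) (interval-+ a d 1) ⟩
      count P? (interval a d ++ [ a + d + 0 ])   ≡⟨ count-++ P? (interval a d) [ a + d + 0 ] ⟩
      window a + count P? [ a + d + 0 ]          ≡⟨ cong (_+_ (window a)) (count-[]-⇔ P? period) ⟩
      window a + count P? [ a + 0 ]              ≡⟨ +-comm (window a) _ ⟩
      count P? [ a + 0 ] + window a              ∎)
      where
      open ≡-Reasoning
      period : P (a + d + 0) ⇔ P (a + 0)
      period = subst₂ (λ x y → P x ⇔ P y) (sym (+-identityʳ _)) (sym (+-identityʳ a)) (periodic a)

    window-constant : ∀ a → window a ≡ window 0
    window-constant zero    = refl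
    window-constant (suc a) = trans (cong window (+-comm 1 a)) (trans (window-step a) (window-constant a))

    window-hit : ∀ a → 1 ≤ window a
    window-hit a = subst (1 ≤_) (trans (window-constant i₀) (sym (window-constant a)))
      (filter-some P? (Any.map (λ { refl → subst P (sym (+-identityʳ i₀)) P[i₀] })
                               (∈-applyUpTo⁺ (_+_ i₀) (>-nonZero⁻¹ d))))

  count-interval-blocks : ∀ q a → q ≤ count P? (interval a (q * d))
  count-interval-blocks zero    a = z≤n
  count-interval-blocks (suc q) a = begin
    1 + q                                                 ≤⟨ +-mono-≤ (window-hit a) (count-interval-blocks q (a + d)) ⟩
    window a + count P? (interval (a + d) (q * d))        ≡⟨ count-++ P? (interval a d) _ ⟨
    count P? (interval a d ++ interval (a + d) (q * d))   ≡⟨ cong (count P?) (interval-+ a d (q * d)) ⟨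
    count P? (interval a (d + q * d))                     ∎
    where open ≤-Reasoning

  count-interval-quotient : ∀ a n → n / d ≤ count P? (interval a n)
  count-interval-quotient a n = begin
    n / d                                                         ≤⟨ count-interval-blocks (n / d) a ⟩
    count P? (interval a (n / d * d))                             ≤⟨ m≤m+n _ _ ⟩
    count P? (interval a (n / d * d)) + count P? (interval _ (n % d)) ≡⟨ count-++ P? (interval a (n / d * d)) _ ⟨
    count P? (interval a (n / d * d) ++ interval _ (n % d))       ≡⟨ cong (count P?) (interval-+ a (n / d * d) (n % d)) ⟨
    count P? (interval a (n / d * d + n % d))                     ≡⟨ cong (count P? ∘ interval a) n≡[n/d]*d+n%d ⟨
    count P? (interval a n)                                       ∎
    where
    open ≤-Reasoning
    n≡[n/d]*d+n%d : n ≡ n / d * d + n % d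
    n≡[n/d]*d+n%d = trans (m≡m%n+[m/n]*n n d) (+-comm (n % d) _)

odd-∣-double⇒∣ : ∀ h i → suc (2 * h) ∣ 2 * i → suc (2 * h) ∣ i
odd-∣-double⇒∣ h i d∣2i = ∣m+n∣m⇒∣n (divides i (expand h i)) (∣-trans d∣2i (n∣m*n h))
  where
  expand : ∀ h i → h * (2 * i) + i ≡ i * suc (2 * h)
  expand = ℕ.solve-∀

count-∣-e+2i-≥ : ∀ h e n → n / suc (2 * h) ≤ count (λ i → suc (2 * h) ∣? e + 2 * i) (range1 n)
count-∣-e+2i-≥ h e n = subst (λ xs → n / d ≤ count P? xs) (sym (map-upTo suc n))
  (count-interval-quotient P? d periodic {h * e} (divides e (witness h e)) 1 n)
  where
  d : ℕ
  d = suc (2 * h)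
  P? : Decidable (λ i → d ∣ e + 2 * i)
  P? i = d ∣? e + 2 * i
  shift-by-d : ∀ e i d → e + 2 * (i + d) ≡ 2 * d + (e + 2 * i)
  shift-by-d = ℕ.solve-∀
  witness : ∀ h e → e + 2 * (h * e) ≡ e * suc (2 * h)
  witness = ℕ.solve-∀
  periodic : ∀ i → d ∣ e + 2 * (i + d) ⇔ d ∣ e + 2 * i
  periodic i = mk⇔ (λ d∣ → ∣m+n∣m⇒∣n (subst (d ∣_) (shift-by-d e i d) d∣) (n∣m*n 2))
                   (λ d∣ → subst (d ∣_) (sym (shift-by-d e i d)) (∣m∣n⇒∣m+n (n∣m*n 2) d∣))

-- The cyclotomic factors of w_n and φ_n

denominatorIndices : ℕ → List ℕ
denominatorIndices n = concatMap (λ i → divisors (2 * i)) (range1 n)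

numeratorIndices : ℕ → ℕ → List ℕ
numeratorIndices e n = concatMap (λ i → divisors (e + 2 * i)) (range1 n)

varphiIndices : ℕ → List ℕ
varphiIndices n = concatMap (λ j → replicate (n / suc j) (2 * suc j)) (upTo n)

denominator-exponents-positive : ∀ n → All (λ i → 1 ≤ 2 * i) (range1 n)
denominator-exponents-positive = range1-all (λ i → s≤s z≤n)

numerator-exponents-positive : ∀ e n → All (λ i → 1 ≤ e + 2 * i) (range1 n)
numerator-exponents-positive e = range1-all (λ i → ≤-trans (s≤s z≤n) (m≤n+m (2 * suc i) e))

multiplicity-denominatorIndices : ∀ d n →
  multiplicity _≟_ d (denominatorIndices n) ≡ count (λ i → d ∣? 2 * i) (range1 n)
multiplicity-denominatorIndices d n = multiplicity-concatMap-divisors d (2 *_) (denominator-exponents-positive n)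

multiplicity-numeratorIndices : ∀ d e n →
  multiplicity _≟_ d (numeratorIndices e n) ≡ count (λ i → d ∣? e + 2 * i) (range1 n)
multiplicity-numeratorIndices d e n =
  multiplicity-concatMap-divisors d (λ i → e + 2 * i) (numerator-exponents-positive e n)

multiplicity-varphiIndices : ∀ k n → n / suc k ≤ multiplicity _≟_ (2 * suc k) (varphiIndices n)
multiplicity-varphiIndices k n with k <? n
... | yes k<n = ≤-trans (≤-reflexive (sym (multiplicity-replicate _≟_ (n / suc k) (2 * suc k))))
                        (count-∈-concat (2 * suc k ≟_) (∈-map⁺ (λ j → replicate (n / suc j) (2 * suc j)) (∈-upTo⁺ k<n)))
... | no k≮n  = ≤-trans (≤-reflexive (m<n⇒m/n≡0 (s≤s (≮⇒≥ k≮n)))) z≤n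

even-or-odd : ∀ d → (∃ λ k → d ≡ 2 * k) ⊎ (∃ λ h → d ≡ suc (2 * h))
even-or-odd zero    = inj₁ (0 , refl)
even-or-odd (suc d) with even-or-odd d
... | inj₁ (k , refl) = inj₂ (k , refl)
... | inj₂ (h , refl) = inj₁ (suc h , cong suc (sym (+-suc h (h + 0))))

denominatorIndices-dominated : ∀ e n d →
  multiplicity _≟_ d (denominatorIndices n) ≤ multiplicity _≟_ d (varphiIndices n ++ numeratorIndices e n)
denominatorIndices-dominated e n d = begin
  multiplicity _≟_ d (denominatorIndices n)  ≡⟨ multiplicity-denominatorIndices d n ⟩
  count (λ i → d ∣? 2 * i) (range1 n)        ≤⟨ bound (even-or-odd d) ⟩
  multiplicity _≟_ d (varphiIndices n) + multiplicity _≟_ d (numeratorIndices e n)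
    ≡⟨ count-++ (d ≟_) (varphiIndices n) (numeratorIndices e n) ⟨
  multiplicity _≟_ d (varphiIndices n ++ numeratorIndices e n) ∎
  where
  open ≤-Reasoning
  bound : (∃ λ k → d ≡ 2 * k) ⊎ (∃ λ h → d ≡ suc (2 * h)) →
    count (λ i → d ∣? 2 * i) (range1 n) ≤ multiplicity _≟_ d (varphiIndices n) + multiplicity _≟_ d (numeratorIndices e n)
  bound (inj₁ (zero , refl)) = ≤-trans (≤-reflexive (count-none (λ i → 0 ∣? 2 * i) (range1-all 0∤2[1+i] n))) z≤n
    where
    0∤2[1+i] : ∀ i → ¬ 0 ∣ 2 * suc i
    0∤2[1+i] i 0∣ with () ← 0∣⇒≡0 0∣
  bound (inj₁ (suc k , refl)) = begin
    count (λ i → 2 * suc k ∣? 2 * i) (range1 n) ≤⟨ count-mono (λ i → 2 * suc k ∣? 2 * i) (suc k ∣?_) (*-cancelˡ-∣ 2) (range1 n) ⟩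
    count (suc k ∣?_) (range1 n)                ≤⟨ count-multiples-≤ (suc k) n ⟩
    n / suc k                                   ≤⟨ multiplicity-varphiIndices k n ⟩
    multiplicity _≟_ (2 * suc k) (varphiIndices n) ≤⟨ m≤m+n _ _ ⟩
    _ ∎
  bound (inj₂ (h , refl)) = begin
    count (λ i → d ∣? 2 * i) (range1 n)         ≤⟨ count-mono (λ i → d ∣? 2 * i) (d ∣?_) (odd-∣-double⇒∣ h _) (range1 n) ⟩
    count (d ∣?_) (range1 n)                    ≤⟨ count-multiples-≤ d n ⟩
    n / d                                       ≤⟨ count-∣-e+2i-≥ h e n ⟩
    count (λ i → d ∣? e + 2 * i) (range1 n)     ≡⟨ multiplicity-numeratorIndices d e n ⟨
    multiplicity _≟_ d (numeratorIndices e n)   ≤⟨ m≤n+m _ _ ⟩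
    _ ∎

module _ (Φ : ℕ → Poly) where

  Π : List ℕ → Poly
  Π ds = prodₚ (map Φ ds)

  Π-++ : ∀ ds es → Π (ds ++ es) ≋ Π ds *ₚ Π es
  Π-++ ds es = ≋-trans (≋-reflexive (cong prodₚ (map-++ Φ ds es))) (prodₚ-++ (map Φ ds) (map Φ es))

  Π-↭ : ∀ {ds es} → ds ↭ es → Π ds ≋ Π es
  Π-↭ ds↭es = prodₚ-↭ (↭.map⁺ Φ ds↭es)

  Π-concatMap : ∀ (g : A → List ℕ) xs → Π (concatMap g xs) ≋ prodₚ (map (Π ∘ g) xs)
  Π-concatMap g []       = ≋-refl
  Π-concatMap g (x ∷ xs) = ≋-trans (Π-++ (g x) (concatMap g xs)) (*ₚ-congˡ (Π (g x)) (Π-concatMap g xs))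

  Π-replicate : ∀ m d → Φ d ^ₚ m ≡ Π (replicate m d)
  Π-replicate zero    d = refl
  Π-replicate (suc m) d = cong (Φ d *ₚ_) (Π-replicate m d)

  varphi≋Π : ∀ n → varphi Φ n ≋ Π (varphiIndices n)
  varphi≋Π n = ≋-trans (≋-reflexive (cong prodₚ (map-cong (λ j → Π-replicate (n / suc j) (2 * suc j)) (upTo n))))
                       (≋-sym (Π-concatMap (λ j → replicate (n / suc j) (2 * suc j)) (upTo n)))

module _ (Φ : ℕ → Poly) (Φ-cyclotomic : IsCyclotomic Φ) where

  1-Xpow≋ : ∀ t → 1 ≤ t → oneₚ -ₚ Xpow t ≋ negₚ oneₚ *ₚ Π Φ (divisors t)
  1-Xpow≋ t 1≤t =
    ≋-trans (1-p≋-1*[p-1] (Xpow t)) (*ₚ-congˡ (negₚ oneₚ) (≋-sym (coeffwise (Φ-cyclotomic t 1≤t))))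

  prodₚ-1-Xpow≋ : ∀ (f : ℕ → ℕ) {xs} → All (λ i → 1 ≤ f i) xs →
    prodₚ (map (λ i → oneₚ -ₚ Xpow (f i)) xs) ≋ negₚ oneₚ ^ₚ length xs *ₚ Π Φ (concatMap (divisors ∘ f) xs)
  prodₚ-1-Xpow≋ f []                        = ≋-sym (*ₚ-identityˡ oneₚ)
  prodₚ-1-Xpow≋ f {x ∷ xs} (1≤fx ∷ 1≤f[xs]) = begin
    (oneₚ -ₚ Xpow (f x)) *ₚ prodₚ (map (λ i → oneₚ -ₚ Xpow (f i)) xs)
      ≈⟨ *ₚ-cong (1-Xpow≋ (f x) 1≤fx) (prodₚ-1-Xpow≋ f 1≤f[xs]) ⟩
    (−1 *ₚ D) *ₚ (σ *ₚ Ds)   ≈⟨ *ₚ-interchange −1 D σ Ds ⟩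
    (−1 *ₚ σ) *ₚ (D *ₚ Ds)   ≈⟨ *ₚ-congˡ (−1 *ₚ σ) (Π-++ Φ (divisors (f x)) (concatMap (divisors ∘ f) xs)) ⟨
    (−1 *ₚ σ) *ₚ Π Φ (divisors (f x) ++ concatMap (divisors ∘ f) xs) ∎
    where
    open ≋-Reasoning
    −1 σ D Ds : Poly
    −1 = negₚ oneₚ
    σ  = −1 ^ₚ length xs
    D  = Π Φ (divisors (f x))
    Ds = Π Φ (concatMap (divisors ∘ f) xs)

  wDen≋Π : ∀ n → wDen n ≋ negₚ oneₚ ^ₚ length (range1 n) *ₚ Π Φ (denominatorIndices n)
  wDen≋Π n = prodₚ-1-Xpow≋ (2 *_) (denominator-exponents-positive n)

  wNum≋Π : ∀ e n → wNum e n ≋ negₚ oneₚ ^ₚ length (range1 n) *ₚ Π Φ (numeratorIndices e n)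
  wNum≋Π e n = prodₚ-1-Xpow≋ (λ i → e + 2 * i) (numerator-exponents-positive e n)

lemma4p1 : (Φ : ℕ → Poly) → IsCyclotomic Φ →
    (e n : ℕ) → e % 2 ≡ 1 → 1 ≤ n →
    Σ Poly (λ P → P *ₚ wDen n ≈ₚ varphi Φ n *ₚ wNum e n)
lemma4p1 Φ Φ-cyclotomic e n _ _
  with zs , V++N↭D++zs ← multiplicities-≤⇒↭-++ _≟_ (denominatorIndices n)
                           (varphiIndices n ++ numeratorIndices e n) (denominatorIndices-dominated e n)
  = Π Φ zs , coeff-≡ (begin
    Π Φ zs *ₚ wDen n               ≈⟨ *ₚ-congˡ (Π Φ zs) (wDen≋Π Φ Φ-cyclotomic n) ⟩
    Π Φ zs *ₚ (σ *ₚ Π Φ D)         ≈⟨ *ₚ-swapˡ (Π Φ zs) σ (Π Φ D) ⟩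
    σ *ₚ (Π Φ zs *ₚ Π Φ D)         ≈⟨ *ₚ-congˡ σ (≋-trans (*ₚ-comm (Π Φ zs) (Π Φ D)) (≋-sym (Π-++ Φ D zs))) ⟩
    σ *ₚ Π Φ (D ++ zs)             ≈⟨ *ₚ-congˡ σ (≋-trans (≋-sym (Π-↭ Φ V++N↭D++zs)) (Π-++ Φ V N)) ⟩
    σ *ₚ (Π Φ V *ₚ Π Φ N)          ≈⟨ *ₚ-swapˡ σ (Π Φ V) (Π Φ N) ⟩
    Π Φ V *ₚ (σ *ₚ Π Φ N)          ≈⟨ *ₚ-cong (varphi≋Π Φ n) (wNum≋Π Φ Φ-cyclotomic e n) ⟨
    varphi Φ n *ₚ wNum e n         ∎)
  where
  open ≋-Reasoning
  D N V : List ℕ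
  D = denominatorIndices n
  N = numeratorIndices e n
  V = varphiIndices n
  σ : Poly
  σ = negₚ oneₚ ^ₚ length (range1 n)
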